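{- Every shortest path graph is $K_{2,3}$-free, i.e., contains no induced subgraph isomorphic to the complete bipartite graph $K_{2,3}$.
   Context: For a simple graph $G$ and distinct $a,b\in V(G)$, the shortest path graph $S(G,a,b)$ has as vertices the shortest $a$–$b$ paths in $G$, two being adjacent iff their vertex sets differ in exactly one vertex. A shortest path graph is any graph isomorphic to some $S(G,a,b)$. -}

module Defs where

open import Data.Nat using (ℕ; _≤_; _<_)
open import Data.Fin using (Fin; toℕ)
open import Data.List using (List; []; _∷_; head; last; length)
open import Data.List.Membership.Propositional using (_∈_; _∉_)
open import Data.List.Relation.Unary.Unique.Propositional using (Unique)
open import Data.Maybe using (Maybe; just)
open import Data.Product using (Σ; _×_; ∃-syntax)
open import Data.Sum using (_⊎_)
open import Data.Unit using (⊤)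
open import Data.Empty using (⊥)
open import Relation.Nullary using (¬_)
open import Relation.Binary.PropositionalEquality using (_≡_; _≢_)
open import Function.Bundles using (_⇔_)

record SimpleGraph (n : ℕ) : Set₁ where
  field
    Adj     : Fin n → Fin n → Set
    symm    : ∀ {x y} → Adj x y → Adj y x
    irrefl  : ∀ {x} → ¬ Adj x x
open SimpleGraph public

Chain : ∀ {n} → (Fin n → Fin n → Set) → List (Fin n) → Set
Chain R []           = ⊤
Chain R (x ∷ [])     = ⊤
Chain R (x ∷ y ∷ xs) = R x y × Chain R (y ∷ xs)

IsPath : ∀ {n} → SimpleGraph n → Fin n → Fin n → List (Fin n) → Set
IsPath G a b p = (head p ≡ just a) × (last p ≡ just b) × Chain (Adj G) p × Unique p

IsShortestPath : ∀ {n} → SimpleGraph n → Fin n → Fin n → List (Fin n) → Set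
IsShortestPath G a b p =
  IsPath G a b p × (∀ q → IsPath G a b q → length p ≤ length q)

OneOutside : ∀ {n} → List (Fin n) → List (Fin n) → Set
OneOutside p q = ∃[ u ] (u ∈ p × u ∉ q × (∀ w → w ∈ p → w ∉ q → w ≡ u))

-- adjacency in the shortest path graph S(G,a,b):
-- the vertex sets of the two paths differ in exactly one vertex
-- (each has exactly one vertex not in the other).
SPAdj : ∀ {n} → List (Fin n) → List (Fin n) → Set
SPAdj p q = OneOutside p q × OneOutside q p

inSmallPart : Fin 5 → Set
inSmallPart i = toℕ i < 2

K23Adj : Fin 5 → Fin 5 → Set
K23Adj i j = (inSmallPart i × ¬ inSmallPart j) ⊎ (¬ inSmallPart i × inSmallPart j)

SPGHasInducedK23 : {n : ℕ} → SimpleGraph n → Fin n → Fin n → Set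
SPGHasInducedK23 {n} G a b =
  Σ (Fin 5 → List (Fin n)) λ f →
    (∀ i → IsShortestPath G a b (f i)) ×
    (∀ i j → f i ≡ f j → i ≡ j) ×
    (∀ i j → i ≢ j → (SPAdj (f i) (f j) ⇔ K23Adj i j))

-- Read a shortest a–b path p as the sequence k ↦ (k-th vertex of p), with
-- 'nothing' past its end.  The key geometric fact is that a vertex shared by
-- two shortest a–b paths sits at the same position in both: otherwise the
-- prefix of one path followed by the suffix of the other is a strictly
-- shorter a–b walk, and every walk shortens to a path.  Consequently two
-- shortest paths are adjacent in S(G,a,b) exactly when their sequences differ
-- at exactly one position, i.e. S(G,a,b) is an induced subgraph of a Hamming
-- graph (sequences, adjacent when they differ at a single index).
--
-- The theorem
-- then transports an induced K_{2,3} of S(G,a,b) into a Hamming graph.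
module Submission where

open import Defs
open import Data.Nat using (ℕ; zero; suc; _+_; _∸_; _≤_; _<_; z≤n; s≤s; _<?_)
open import Data.Nat.Properties
  using (≤-refl; ≤-trans; ≤-<-trans; m≤n⇒m≤1+n; ≤-antisym; <-irrefl; +-monoˡ-<; m+[n∸m]≡n; <-cmp; suc-injective)
  renaming (_≟_ to _≟ℕ_)
open import Data.Fin using (Fin; toℕ; #_; _≟_)
open import Data.List using (List; []; _∷_; head; last; length)
open import Data.List.Membership.Propositional using (_∈_; _∉_)
open import Data.List.Membership.DecPropositional using () renaming (_∈?_ to member?)
open import Data.List.Relation.Unary.Any using (here; there)
open import Data.List.Relation.Unary.All as All using (All)
open import Data.List.Relation.Unary.AllPairs using ([]; _∷_)
open import Data.List.Relation.Unary.Unique.Propositional using (Unique)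
open import Data.Maybe using (Maybe; just; nothing)
open import Data.Maybe.Properties using (just-injective)
open import Data.Product using (_×_; _,_; ∃-syntax)
open import Data.Unit using (tt)
open import Data.Empty using (⊥; ⊥-elim)
open import Relation.Nullary using (¬_; Dec; yes; no)
open import Relation.Nullary.Decidable
  using (True; False; toWitness; toWitnessFalse; decidable-stable; ¬?; _×-dec_; _⊎-dec_)
open import Relation.Binary using (tri<; tri≈; tri>)
open import Relation.Binary.PropositionalEquality
  using (_≡_; _≢_; refl; sym; trans; cong; subst; _≗_; ≢-sym; module ≡-Reasoning)
open import Function.Bundles using (_⇔_; mk⇔; Equivalence)

module Positions {A : Set} where

  at : List A → ℕ → Maybe A
  at []       _       = nothing
  at (x ∷ xs) zero    = just x
  at (x ∷ xs) (suc k) = at xs k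

  at-injective : ∀ xs ys → at xs ≗ at ys → xs ≡ ys
  at-injective []       []       _  = refl
  at-injective []       (y ∷ ys) eq with eq 0
  ... | ()
  at-injective (x ∷ xs) []       eq with eq 0
  ... | ()
  at-injective (x ∷ xs) (y ∷ ys) eq with eq 0
  ... | refl = cong (x ∷_) (at-injective xs ys (λ k → eq (suc k)))

  ∈⇒at : ∀ {x xs} → x ∈ xs → ∃[ k ] at xs k ≡ just x
  ∈⇒at (here refl) = 0 , refl
  ∈⇒at (there x∈xs) with ∈⇒at x∈xs
  ... | k , eq = suc k , eq

  at⇒∈ : ∀ {x} xs k → at xs k ≡ just x → x ∈ xs
  at⇒∈ (y ∷ ys) zero    refl = here refl
  at⇒∈ (y ∷ ys) (suc k) eq   = there (at⇒∈ ys k eq)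

  at⇒< : ∀ {x} xs k → at xs k ≡ just x → k < length xs
  at⇒< (y ∷ ys) zero    _  = s≤s z≤n
  at⇒< (y ∷ ys) (suc k) eq = s≤s (at⇒< ys k eq)

  at-unique : ∀ {x xs} → Unique xs → ∀ i j → at xs i ≡ just x → at xs j ≡ just x → i ≡ j
  at-unique {xs = y ∷ ys} _ zero zero _ _ = refl
  at-unique {xs = y ∷ ys} (y∉ys ∷ _) zero (suc j) refl eq =
    ⊥-elim (All.lookup y∉ys (at⇒∈ ys j eq) refl)
  at-unique {xs = y ∷ ys} (y∉ys ∷ _) (suc i) zero eq refl =
    ⊥-elim (All.lookup y∉ys (at⇒∈ ys i eq) refl)
  at-unique {xs = y ∷ ys} (_ ∷ u) (suc i) (suc j) eqi eqj = cong suc (at-unique u i j eqi eqj)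

  at-end : ∀ xs ys k → length xs ≡ length ys → at xs k ≡ nothing → at ys k ≡ nothing
  at-end []       []       k       _  _  = refl
  at-end (x ∷ xs) (y ∷ ys) (suc k) eq end = at-end xs ys k (suc-injective eq) end

module Hamming {B : Set} where

  DiffersOnlyAt : (ℕ → B) → (ℕ → B) → ℕ → Set
  DiffersOnlyAt s t i = s i ≢ t i × (∀ k → k ≢ i → s k ≡ t k)

  HammingAdj : (ℕ → B) → (ℕ → B) → Set
  HammingAdj s t = ∃[ i ] DiffersOnlyAt s t i

  differs-sym : ∀ {s t i} → DiffersOnlyAt s t i → DiffersOnlyAt t s i
  differs-sym (s≢t , agree) = ≢-sym s≢t , λ k k≢i → sym (agree k k≢i)

  agree-off⇒adjacent : ∀ {s t} i → (∀ k → k ≢ i → s k ≡ t k) → ¬ s ≗ t → HammingAdj s t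
  agree-off⇒adjacent {s} {t} i agree s≉t = i , (λ eq → s≉t (everywhere eq)) , agree
    where
      everywhere : s i ≡ t i → s ≗ t
      everywhere eq k with k ≟ℕ i
      ... | yes refl = eq
      ... | no  k≢i  = agree k k≢i

  distinct-positions : ∀ {c s t i j} → DiffersOnlyAt c s i → DiffersOnlyAt c t j →
                       ¬ s ≗ t → ¬ HammingAdj s t → i ≢ j
  distinct-positions {i = i} (_ , c≈s) (_ , c≈t) s≉t s≁t refl =
    s≁t (agree-off⇒adjacent i (λ k k≢i → trans (sym (c≈s k k≢i)) (c≈t k k≢i)) s≉t)

  -- In a 4-cycle x–u–y–v, if x leaves u and v at different positions i ≢ i′
  -- and y leaves v at a position j′ ≢ i′, then y leaves u exactly at i′:
  -- elsewhere y would agree with x at i′, through u and through v.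
  crossing-position : ∀ {x y u v i j i′ j′} →
                      DiffersOnlyAt x u i → DiffersOnlyAt y u j →
                      DiffersOnlyAt x v i′ → DiffersOnlyAt y v j′ →
                      i ≢ i′ → j′ ≢ i′ → i′ ≡ j
  crossing-position {x} {y} {u} {v} {i} {j} {i′} (_ , x≈u) (_ , y≈u) (x≢v , _) (_ , y≈v) i≢i′ j′≢i′ =
    decidable-stable (i′ ≟ℕ j) λ i′≢j → x≢v (begin
      x i′ ≡⟨ x≈u i′ (≢-sym i≢i′) ⟩
      u i′ ≡⟨ sym (y≈u i′ i′≢j) ⟩
      y i′ ≡⟨ y≈v i′ (≢-sym j′≢i′) ⟩
      v i′ ∎)
    where open ≡-Reasoning

  -- Hamming graphs contain no induced K_{2,3} with parts {x, y} and {u, v, w}: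
  -- x leaves u, v, w at three different positions, yet y forces the
  -- positions for v and w to coincide.
  no-induced-K23 : ∀ {x y u v w} →
    HammingAdj x u → HammingAdj x v → HammingAdj x w →
    HammingAdj y u → HammingAdj y v → HammingAdj y w →
    ¬ x ≗ y → ¬ HammingAdj x y →
    ¬ u ≗ v → ¬ HammingAdj u v → ¬ u ≗ w → ¬ HammingAdj u w → ¬ v ≗ w → ¬ HammingAdj v w → ⊥
  no-induced-K23 {x} {y} {u} (_ , xu) (_ , xv) (_ , xw) (j , yu) (_ , yv) (_ , yw)
                 x≉y x≁y u≉v u≁v u≉w u≁w v≉w v≁w =
    distinct-positions xv xw v≉w v≁w (trans (meets-u xv yv u≉v u≁v) (sym (meets-u xw yw u≉w u≁w)))
    where
      meets-u : ∀ {t i′ j′} → DiffersOnlyAt x t i′ → DiffersOnlyAt y t j′ →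
                ¬ u ≗ t → ¬ HammingAdj u t → i′ ≡ j
      meets-u xt yt u≉t u≁t =
        crossing-position xu yu xt yt (distinct-positions xu xt u≉t u≁t)
          (≢-sym (distinct-positions (differs-sym xt) (differs-sym yt) x≉y x≁y))

module Walks {n : ℕ} (G : SimpleGraph n) where

  data Walk : Fin n → Fin n → ℕ → Set where
    []  : ∀ {x} → Walk x x 0
    _∷_ : ∀ {x y z m} → Adj G x y → Walk y z m → Walk x z (suc m)

  _++ʷ_ : ∀ {x y z i j} → Walk x y i → Walk y z j → Walk x z (i + j)
  []      ++ʷ w′ = w′
  (e ∷ w) ++ʷ w′ = e ∷ (w ++ʷ w′)

  path-cons : ∀ {v x y p} → Adj G v x → v ∉ p → IsPath G x y p → IsPath G v y (v ∷ p)
  path-cons {p = x ∷ xs} e v∉p (refl , ends , chain , unique) =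
    refl , ends , (e , chain) , All.tabulate (λ w∈p v≡w → v∉p (subst (_∈ x ∷ xs) (sym v≡w) w∈p)) ∷ unique

  path-suffix : ∀ {v x y p} → IsPath G x y p → v ∈ p → ∃[ q ] IsPath G v y q × length q ≤ length p
  path-suffix {p = p} path@(refl , _) (here refl) = p , path , ≤-refl
  path-suffix {p = _ ∷ z ∷ zs} (refl , ends , (_ , chain) , (_ ∷ unique)) (there v∈p)
    with path-suffix {p = z ∷ zs} (refl , ends , chain , unique) v∈p
  ... | q , path , short = q , path , m≤n⇒m≤1+n short

  walk⇒path : ∀ {x y m} → Walk x y m → ∃[ p ] IsPath G x y p × length p ≤ suc m
  walk⇒path {x} [] = x ∷ [] , (refl , refl , tt , All.[] ∷ []) , ≤-refl
  walk⇒path {x} (e ∷ w) with walk⇒path w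
  ... | p , path , short with member? _≟_ x p
  ...   | yes x∈p = let q , path′ , shorter = path-suffix path x∈p
                    in q , path′ , ≤-trans shorter (m≤n⇒m≤1+n short)
  ...   | no  x∉p = x ∷ p , path-cons e x∉p path , s≤s short

  open Positions

  prefix-walk : ∀ {x v} xs i → Chain (Adj G) xs → head xs ≡ just x → at xs i ≡ just v → Walk x v i
  prefix-walk (z ∷ zs)     zero    _            refl refl = []
  prefix-walk (z ∷ z′ ∷ zs) (suc i) (e , chain) refl eq  = e ∷ prefix-walk (z′ ∷ zs) i chain refl eq

  chain-walk : ∀ {y} z zs → Chain (Adj G) (z ∷ zs) → last (z ∷ zs) ≡ just y → Walk z y (length zs)
  chain-walk z []        _           refl = []
  chain-walk z (z′ ∷ zs) (e , chain) ends = e ∷ chain-walk z′ zs chain ends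

  suffix-walk : ∀ {y v} xs j → Chain (Adj G) xs → last xs ≡ just y → at xs j ≡ just v →
                Walk v y (length xs ∸ suc j)
  suffix-walk (z ∷ zs)      zero    chain       ends refl = chain-walk z zs chain ends
  suffix-walk (z ∷ z′ ∷ zs) (suc j) (_ , chain) ends eq   = suffix-walk (z′ ∷ zs) j chain ends eq

module ShortestPaths {n : ℕ} (G : SimpleGraph n) (a b : Fin n) where

  open Positions
  open Hamming
  open Walks G

  Shortest : List (Fin n) → Set
  Shortest = IsShortestPath G a b

  shortest-length : ∀ {p q} → Shortest p → Shortest q → length p ≡ length q
  shortest-length (path-p , min-p) (path-q , min-q) = ≤-antisym (min-p _ path-q) (min-q _ path-p)

  -- skipping from position j back to position i < j saves at least one vertex
  splice-shorter : ∀ i j m → i < j → j < m → suc (i + (m ∸ suc j)) < m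
  splice-shorter i j m i<j j<m =
    subst (suc (i + (m ∸ suc j)) <_) (m+[n∸m]≡n j<m) (s≤s (+-monoˡ-< (m ∸ suc j) i<j))

  -- a vertex of two shortest paths cannot come strictly earlier in the first:
  -- the first path's prefix and the second's suffix would form a shorter a–b walk
  no-earlier-position : ∀ {p q i j v} → Shortest p → Shortest q →
                        at p i ≡ just v → at q j ≡ just v → ¬ i < j
  no-earlier-position {p} {q} {i} {j} ((starts , _ , chain-p , _) , _) ((_ , ends , chain-q , _) , min-q)
                      p[i] q[j] i<j
    with walk⇒path (prefix-walk p i chain-p starts p[i] ++ʷ suffix-walk q j chain-q ends q[j])
  ... | r , path-r , short =
    <-irrefl refl (≤-<-trans (≤-trans (min-q r path-r) short)
                             (splice-shorter i j (length q) i<j (at⇒< q j q[j])))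

  same-position : ∀ {p q i j v} → Shortest p → Shortest q → at p i ≡ just v → at q j ≡ just v → i ≡ j
  same-position {i = i} {j} sp sq p[i] q[j] with <-cmp i j
  ... | tri< i<j _ _ = ⊥-elim (no-earlier-position sp sq p[i] q[j] i<j)
  ... | tri≈ _ i≡j _ = i≡j
  ... | tri> _ _ j<i = ⊥-elim (no-earlier-position sq sp q[j] p[i] j<i)

  shared-vertex : ∀ {p q k w} → Shortest p → Shortest q → at p k ≡ just w → w ∈ q → at q k ≡ just w
  shared-vertex sp sq p[k] w∈q with ∈⇒at w∈q
  ... | j , q[j] rewrite same-position sp sq p[k] q[j] = q[j]

  unique : ∀ {p} → Shortest p → Unique p
  unique ((_ , _ , _ , u) , _) = u

  one-outside⇒differs : ∀ {p q} → Shortest p → Shortest q → OneOutside p q → HammingAdj (at p) (at q)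
  one-outside⇒differs {p} {q} sp sq (u , u∈p , u∉q , only-u) with ∈⇒at u∈p
  ... | i , p[i] = i , p[i]≢q[i] , agree
    where
      p[i]≢q[i] : at p i ≢ at q i
      p[i]≢q[i] eq = u∉q (at⇒∈ q i (trans (sym eq) p[i]))

      agree : ∀ k → k ≢ i → at p k ≡ at q k
      agree k k≢i with at p k in p[k]
      ... | nothing = sym (at-end p q k (shortest-length sp sq) p[k])
      ... | just w with member? _≟_ w q
      ...   | yes w∈q = sym (shared-vertex sp sq p[k] w∈q)
      ...   | no  w∉q = ⊥-elim (k≢i (at-unique (unique sp) k i
                                      (trans p[k] (cong just (only-u w (at⇒∈ p k p[k]) w∉q))) p[i]))

  differs⇒one-outside : ∀ {p q i} → Shortest p → Shortest q → DiffersOnlyAt (at p) (at q) i → OneOutside p q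
  differs⇒one-outside {p} {q} {i} sp sq (p[i]≢q[i] , agree) with at p i in p[i]
  ... | nothing = ⊥-elim (p[i]≢q[i] (sym (at-end p q i (shortest-length sp sq) p[i])))
  ... | just u  = u , at⇒∈ p i p[i] , u∉q , only-u
    where
      u∉q : u ∉ q
      u∉q u∈q = p[i]≢q[i] (sym (shared-vertex sp sq p[i] u∈q))

      only-u : ∀ w → w ∈ p → w ∉ q → w ≡ u
      only-u w w∈p w∉q with ∈⇒at w∈p
      ... | k , p[k] with k ≟ℕ i
      ...   | yes refl = just-injective (trans (sym p[k]) p[i])
      ...   | no  k≢i  = ⊥-elim (w∉q (at⇒∈ q k (trans (sym (agree k k≢i)) p[k])))

  adjacent⇔hamming : ∀ {p q} → Shortest p → Shortest q → SPAdj p q ⇔ HammingAdj (at p) (at q)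
  adjacent⇔hamming sp sq = mk⇔
    (λ (p⊄q , _) → one-outside⇒differs sp sq p⊄q)
    (λ (_ , d) → differs⇒one-outside sp sq d , differs⇒one-outside sq sp (differs-sym d))

-- adjacency in K_{2,3} is decidable, so concrete edges are checked by evaluation
K23Adj? : ∀ i j → Dec (K23Adj i j)
K23Adj? i j = (small? i ×-dec ¬? (small? j)) ⊎-dec (¬? (small? i) ×-dec small? j)
  where
    small? : ∀ k → Dec (inSmallPart k)
    small? k = toℕ k <? 2

proposition12 : ∀ {n} (G : SimpleGraph n) (a b : Fin n) → a ≢ b → ¬ SPGHasInducedK23 G a b
proposition12 {n} G a b _ (f , shortest , injective , induced) =
  no-induced-K23 (edge (# 0) (# 2)) (edge (# 0) (# 3)) (edge (# 0) (# 4))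
                 (edge (# 1) (# 2)) (edge (# 1) (# 3)) (edge (# 1) (# 4))
                 (distinct (# 0) (# 1)) (non-edge (# 0) (# 1))
                 (distinct (# 2) (# 3)) (non-edge (# 2) (# 3))
                 (distinct (# 2) (# 4)) (non-edge (# 2) (# 4))
                 (distinct (# 3) (# 4)) (non-edge (# 3) (# 4))
  where
    open Positions
    open Hamming
    open ShortestPaths G a b

    s : Fin 5 → ℕ → Maybe (Fin n)
    s i = at (f i)

    edge : ∀ i j {_ : False (i ≟ j)} {_ : True (K23Adj? i j)} → HammingAdj (s i) (s j)
    edge i j {i≢j} {ij} = Equivalence.to (adjacent⇔hamming (shortest i) (shortest j))
                            (Equivalence.from (induced i j (toWitnessFalse i≢j)) (toWitness ij))

    non-edge : ∀ i j {_ : False (i ≟ j)} {_ : False (K23Adj? i j)} → ¬ HammingAdj (s i) (s j)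
    non-edge i j {i≢j} {¬ij} adj = toWitnessFalse ¬ij (Equivalence.to (induced i j (toWitnessFalse i≢j))
                                     (Equivalence.from (adjacent⇔hamming (shortest i) (shortest j)) adj))

    distinct : ∀ i j {_ : False (i ≟ j)} → ¬ s i ≗ s j
    distinct i j {i≢j} s≗ = toWitnessFalse i≢j (injective i j (at-injective (f i) (f j) s≗))
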